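{- Let $H$ be a graph and $k\in\{1,\ldots,\mathcal{C}(K_1+H)\}$. If there exist a vertex $x\in V(H)$ and a $k$-adjacency basis $A$ of $H$ such that $A\subseteq N_H(x)$, then $\operatorname{adim}_k(K_1+H)\le\operatorname{adim}_k(H)+k$.
   Context: All graphs are finite and simple; $N_H(x)$ is the open neighbourhood of $x$. The join $K_1+H$ is obtained from $H$ by adding a new vertex adjacent to all vertices of $H$. For a graph $G=(V,E)$, $d_{G,2}(x,y)=\min\{d_G(x,y),2\}$ with $d_G$ the shortest-path distance ($\infty$ between different components). For distinct $x,y$, $\mathcal{C}_G(x,y)=\{z\in V: d_{G,2}(x,z)\ne d_{G,2}(y,z)\}$, $\mathcal{C}(G)=\min_{x\ne y}|\mathcal{C}_G(x,y)|$. A set $S\subseteq V$ is a $k$-adjacency generator if $|S\cap\mathcal{C}_G(x,y)|\ge k$ for all distinct $x,y$; a minimum one is a $k$-adjacency basis, of cardinality $\operatorname{adim}_k(G)$. -}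

module Defs where

open import Data.Nat using (ℕ; zero; suc; _≤_; _≡ᵇ_)
open import Data.Bool using (Bool; true; false; not; if_then_else_)
open import Data.Fin using (Fin; zero; suc; _≟_)
open import Data.Fin.Subset using (Subset; _∩_; ∣_∣)
open import Data.Vec using (tabulate)
open import Data.Product using (_×_; Σ; ∃)
open import Relation.Binary.PropositionalEquality using (_≡_; _≢_)
open import Relation.Nullary using (yes; no)

record Graph : Set where
  field
    n     : ℕ
    adj   : Fin n → Fin n → Bool
    sym   : ∀ x y → adj x y ≡ adj y x
    irref : ∀ x → adj x x ≡ false

open Graph public

N : (G : Graph) → Fin (n G) → Subset (n G)
N G x = tabulate (λ z → adj G x z)

-- d_{G,2}(x,y) = min{d_G(x,y),2}: 0 if x = y, 1 if adjacent, 2 otherwise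
-- (distance ≥ 2, including ∞ between components).
d2 : (G : Graph) → Fin (n G) → Fin (n G) → ℕ
d2 G x y with x ≟ y
... | yes _ = 0
... | no  _ = if adj G x y then 1 else 2

𝒞 : (G : Graph) → Fin (n G) → Fin (n G) → Subset (n G)
𝒞 G x y = tabulate (λ z → not (d2 G x z ≡ᵇ d2 G y z))

Is𝒞 : Graph → ℕ → Set
Is𝒞 G c =
  (Σ (Fin (n G)) λ x → Σ (Fin (n G)) λ y → x ≢ y × ∣ 𝒞 G x y ∣ ≡ c)
  × (∀ x y → x ≢ y → c ≤ ∣ 𝒞 G x y ∣)

IsAdjGen : ℕ → (G : Graph) → Subset (n G) → Set
IsAdjGen k G S = ∀ x y → x ≢ y → k ≤ ∣ S ∩ 𝒞 G x y ∣

IsAdjBasis : ℕ → (G : Graph) → Subset (n G) → Set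
IsAdjBasis k G S = IsAdjGen k G S × (∀ T → IsAdjGen k G T → ∣ S ∣ ≤ ∣ T ∣)

IsAdim : ℕ → Graph → ℕ → Set
IsAdim k G m = Σ (Subset (n G)) λ S → IsAdjBasis k G S × ∣ S ∣ ≡ m

-- The join K_1 + H; the new vertex is zero, H's vertices are suc v.
joinAdj : ∀ {m} → (Fin m → Fin m → Bool) → Fin (suc m) → Fin (suc m) → Bool
joinAdj a zero    zero    = false
joinAdj a zero    (suc _) = true
joinAdj a (suc _) zero    = true
joinAdj a (suc x) (suc y) = a x y

K1+ : Graph → Graph
K1+ H = record
  { n = suc (n H)
  ; adj = joinAdj (adj H)
  ; sym = s
  ; irref = i
  }
  where
  s : ∀ x y → joinAdj (adj H) x y ≡ joinAdj (adj H) y x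
  s zero zero = _≡_.refl
  s zero (suc y) = _≡_.refl
  s (suc x) zero = _≡_.refl
  s (suc x) (suc y) = sym H x y
  i : ∀ x → joinAdj (adj H) x x ≡ false
  i zero = _≡_.refl
  i (suc x) = irref H x

-- Let v be the apex of K₁ + H and B any k vertices of 𝒞(v, x); they exist because
-- k ≤ 𝒞(K₁ + H) ≤ |𝒞(v, x)|. Then A ∪ B is a k-adjacency generator of K₁ + H of size at
-- most |A| + k. Truncated distances between vertices of H are the same in H and in K₁ + H,
-- so A still separates every pair of vertices of H. Both v and x are at distance 1 from
-- every vertex of A ⊆ N(x), so for u ≠ x the pair (v, u) is separated by A ∩ 𝒞_H(x, u),
-- and the pair (v, x) is separated by B.
module Submission where

open import Defs
open import Data.Nat using (ℕ; _≤_; _+_)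
open import Data.Fin using (Fin)
open import Data.Fin.Subset using (Subset; _⊆_; ∣_∣)

open import Data.Nat using (z≤n; s≤s)
open import Data.Bool using (Bool; not; T)
open import Data.Bool.Properties using (T-≡; T-not-≡; ¬-not)
open import Data.Empty using (⊥-elim)
open import Data.Fin using (zero; suc; _≟_)
open import Data.Fin.Subset using (_∈_; _∩_; _∪_; ⊥; inside; outside)
open import Data.Fin.Subset.Properties
  using (p⊆q⇒∣p∣≤∣q∣; x∈p∩q⁺; x∈p∩q⁻; p⊆p∪q; q⊆p∪q; ⊥⊆; ∣⊥∣≡0; out⊆; s⊆s)
import Data.Nat as ℕ
open import Data.Nat.Properties
  using (≡ᵇ⇒≡; ≡⇒≡ᵇ; ≤-trans; ≤-reflexive; +-suc; n≤1+n; module ≤-Reasoning)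
open import Data.Product using (∃-syntax; _×_; _,_)
open import Data.Vec using (_∷_; []; tabulate; there)
open import Data.Vec.Properties using (lookup∘tabulate; lookup⇒[]=; []=⇒lookup)
open import Function.Bundles using (Equivalence; _⇔_; mk⇔)
open import Relation.Binary.PropositionalEquality as ≡
  using (_≡_; _≢_; refl; trans; cong; subst)
open import Relation.Nullary using (yes; no)

private
  variable
    m : ℕ

∣p∪q∣≤∣p∣+∣q∣ : (p q : Subset m) → ∣ p ∪ q ∣ ≤ ∣ p ∣ + ∣ q ∣
∣p∪q∣≤∣p∣+∣q∣ []            []            = z≤n
∣p∪q∣≤∣p∣+∣q∣ (outside ∷ p) (outside ∷ q) = ∣p∪q∣≤∣p∣+∣q∣ p q
∣p∪q∣≤∣p∣+∣q∣ (outside ∷ p) (inside ∷ q) rewrite +-suc ∣ p ∣ ∣ q ∣ =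
  s≤s (∣p∪q∣≤∣p∣+∣q∣ p q)
∣p∪q∣≤∣p∣+∣q∣ (inside ∷ p)  (outside ∷ q) = s≤s (∣p∪q∣≤∣p∣+∣q∣ p q)
∣p∪q∣≤∣p∣+∣q∣ (inside ∷ p)  (inside ∷ q) rewrite +-suc ∣ p ∣ ∣ q ∣ =
  s≤s (≤-trans (∣p∪q∣≤∣p∣+∣q∣ p q) (n≤1+n _))

subset-of-size : (p : Subset m) {k : ℕ} → k ≤ ∣ p ∣ → ∃[ q ] q ⊆ p × ∣ q ∣ ≡ k
subset-of-size {m} p {ℕ.zero} _ = ⊥ , ⊥⊆ , ∣⊥∣≡0 m
subset-of-size (outside ∷ p) {ℕ.suc k} k<∣p∣ with subset-of-size p k<∣p∣
... | q , q⊆p , ∣q∣≡k = outside ∷ q , out⊆ q⊆p , ∣q∣≡k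
subset-of-size (inside ∷ p) {ℕ.suc k} (s≤s k≤∣p∣) with subset-of-size p k≤∣p∣
... | q , q⊆p , ∣q∣≡k = inside ∷ q , s⊆s q⊆p , cong ℕ.suc ∣q∣≡k

∩-monoʳ-⊆ : (p : Subset m) {q r : Subset m} → q ⊆ r → p ∩ q ⊆ p ∩ r
∩-monoʳ-⊆ p {q} q⊆r x∈p∩q with x∈p∩q⁻ p q x∈p∩q
... | x∈p , x∈q = x∈p∩q⁺ (x∈p , q⊆r x∈q)

out⊆-pointwise : {p : Subset m} {q : Subset (ℕ.suc m)} →
                 (∀ {z} → z ∈ p → suc z ∈ q) → outside ∷ p ⊆ q
out⊆-pointwise suc∈q (there z∈p) = suc∈q z∈p

∈-tabulate⁺ : {f : Fin m → Bool} {x : Fin m} → T (f x) → x ∈ tabulate f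
∈-tabulate⁺ {f = f} {x} fx =
  lookup⇒[]= x _ (trans (lookup∘tabulate f x) (Equivalence.to T-≡ fx))

∈-tabulate⁻ : {f : Fin m → Bool} {x : Fin m} → x ∈ tabulate f → T (f x)
∈-tabulate⁻ {f = f} {x} x∈ =
  Equivalence.from T-≡ (trans (≡.sym (lookup∘tabulate f x)) ([]=⇒lookup x∈))

T-not-≡ᵇ⇔≢ : {u v : ℕ} → T (not (u ℕ.≡ᵇ v)) ⇔ u ≢ v
T-not-≡ᵇ⇔≢ {u} {v} = mk⇔
  (λ t u≡v → subst T (Equivalence.to T-not-≡ t) (≡⇒≡ᵇ u v u≡v))
  (λ u≢v → Equivalence.from T-not-≡
    (¬-not (λ e → u≢v (≡ᵇ⇒≡ u v (Equivalence.from T-≡ e)))))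

∈𝒞⁺ : (G : Graph) (a b : Fin (n G)) {z : Fin (n G)} → d2 G a z ≢ d2 G b z → z ∈ 𝒞 G a b
∈𝒞⁺ G a b ne = ∈-tabulate⁺ (Equivalence.from T-not-≡ᵇ⇔≢ ne)

∈𝒞⁻ : (G : Graph) (a b : Fin (n G)) {z : Fin (n G)} → z ∈ 𝒞 G a b → d2 G a z ≢ d2 G b z
∈𝒞⁻ G a b z∈ = Equivalence.to T-not-≡ᵇ⇔≢ (∈-tabulate⁻ z∈)

𝒞-sym : (G : Graph) (a b : Fin (n G)) → 𝒞 G a b ⊆ 𝒞 G b a
𝒞-sym G a b z∈ = ∈𝒞⁺ G b a (λ eq → ∈𝒞⁻ G a b z∈ (≡.sym eq))

d2-N : (G : Graph) {x z : Fin (n G)} → z ∈ N G x → d2 G x z ≡ 1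
d2-N G {x} {z} z∈N with x ≟ z | ∈-tabulate⁻ z∈N
... | yes refl | adj-xx = ⊥-elim (subst T (irref G x) adj-xx)
... | no _     | adj-xz rewrite Equivalence.to T-≡ adj-xz = refl

d2-K1+-suc : (H : Graph) (a b : Fin (n H)) → d2 (K1+ H) (suc a) (suc b) ≡ d2 H a b
d2-K1+-suc H a b with a ≟ b
... | yes refl = refl
... | no _     = refl

module _ (H : Graph) where

  private
    G : Graph
    G = K1+ H

  𝒞-K1+-suc : (u w : Fin (n H)) {z : Fin (n H)} →
              z ∈ 𝒞 H u w → suc z ∈ 𝒞 G (suc u) (suc w)
  𝒞-K1+-suc u w {z} z∈𝒞 = ∈𝒞⁺ G (suc u) (suc w) λ eq → ∈𝒞⁻ H u w z∈𝒞 (begin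
    d2 H u z             ≡⟨ d2-K1+-suc H u z ⟨
    d2 G (suc u) (suc z) ≡⟨ eq ⟩
    d2 G (suc w) (suc z) ≡⟨ d2-K1+-suc H w z ⟩
    d2 H w z             ∎)
    where open ≡.≡-Reasoning

  𝒞-K1+-apex : (x u : Fin (n H)) {z : Fin (n H)} →
               z ∈ N H x → z ∈ 𝒞 H x u → suc z ∈ 𝒞 G zero (suc u)
  𝒞-K1+-apex x u {z} z∈N z∈𝒞 = ∈𝒞⁺ G zero (suc u) λ eq → ∈𝒞⁻ H x u z∈𝒞 (begin
    d2 H x z             ≡⟨ d2-N H z∈N ⟩
    d2 G zero (suc z)    ≡⟨ eq ⟩
    d2 G (suc u) (suc z) ≡⟨ d2-K1+-suc H u z ⟩
    d2 H u z             ∎)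
    where open ≡.≡-Reasoning

  K1+-adjGen : {k : ℕ} {A : Subset (n H)} {B : Subset (n G)} (x : Fin (n H)) →
               IsAdjGen k H A → A ⊆ N H x → B ⊆ 𝒞 G zero (suc x) → k ≤ ∣ B ∣ →
               IsAdjGen k G ((outside ∷ A) ∪ B)
  K1+-adjGen {k} {A} {B} x A-gen A⊆Nx B⊆𝒞 k≤∣B∣ = gen
    where
    S : Subset (n G)
    S = (outside ∷ A) ∪ B

    lift-A∩ : {C : Subset (n H)} {D : Subset (n G)} →
              (∀ {z} → z ∈ A → z ∈ C → suc z ∈ D) → ∣ A ∩ C ∣ ≤ ∣ S ∩ D ∣
    lift-A∩ {C} A∩C→D = p⊆q⇒∣p∣≤∣q∣ (out⊆-pointwise λ z∈A∩C →
      let z∈A , z∈C = x∈p∩q⁻ A C z∈A∩C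
      in  x∈p∩q⁺ (p⊆p∪q B (there z∈A) , A∩C→D z∈A z∈C))

    separated-from-apex : ∀ u → k ≤ ∣ S ∩ 𝒞 G zero (suc u) ∣
    separated-from-apex u with u ≟ x
    ... | yes refl = ≤-trans k≤∣B∣ (p⊆q⇒∣p∣≤∣q∣ λ z∈B →
                       x∈p∩q⁺ (q⊆p∪q (outside ∷ A) B z∈B , B⊆𝒞 z∈B))
    ... | no u≢x   = ≤-trans (A-gen x u (λ x≡u → u≢x (≡.sym x≡u)))
                             (lift-A∩ λ z∈A → 𝒞-K1+-apex x u (A⊆Nx z∈A))

    gen : IsAdjGen k G S
    gen zero    zero    0≢0 = ⊥-elim (0≢0 refl)
    gen zero    (suc u) _   = separated-from-apex u
    gen (suc u) zero    _   = ≤-trans (separated-from-apex u)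
                                      (p⊆q⇒∣p∣≤∣q∣ (∩-monoʳ-⊆ S (𝒞-sym G zero (suc u))))
    gen (suc u) (suc w) u≢w = ≤-trans (A-gen u w (λ u≡w → u≢w (cong suc u≡w)))
                                      (lift-A∩ λ _ → 𝒞-K1+-suc u w)

proposition41 : (H : Graph) (k : ℕ) (c : ℕ) → Is𝒞 (K1+ H) c → 1 ≤ k → k ≤ c →
    (x : Fin (n H)) (A : Subset (n H)) → IsAdjBasis k H A → A ⊆ N H x →
    (m : ℕ) → IsAdim k (K1+ H) m → m ≤ ∣ A ∣ + k
proposition41 H k c (_ , c≤∣𝒞∣) _ k≤c x A (A-gen , _) A⊆Nx m (S , (_ , S-min) , ∣S∣≡m)
  with subset-of-size (𝒞 (K1+ H) zero (suc x)) (≤-trans k≤c (c≤∣𝒞∣ zero (suc x) λ ()))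
... | B , B⊆𝒞 , ∣B∣≡k = begin
  m                     ≡⟨ ∣S∣≡m ⟨
  ∣ S ∣                 ≤⟨ S-min ((outside ∷ A) ∪ B) A∪B-gen ⟩
  ∣ (outside ∷ A) ∪ B ∣ ≤⟨ ∣p∪q∣≤∣p∣+∣q∣ (outside ∷ A) B ⟩
  ∣ A ∣ + ∣ B ∣         ≡⟨ cong (∣ A ∣ +_) ∣B∣≡k ⟩
  ∣ A ∣ + k             ∎
  where
  open ≤-Reasoning
  A∪B-gen : IsAdjGen k (K1+ H) ((outside ∷ A) ∪ B)
  A∪B-gen = K1+-adjGen H x A-gen A⊆Nx B⊆𝒞 (≤-reflexive (≡.sym ∣B∣≡k))
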